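{- For every integer $n>1$, \[ \omega(n-1)=\sum_{\substack{m+k=n\\ m\ge 1,\ k\ge 0}}\mu(m)\sum_{j\ge0}\omega(k-jm), \] where $\mu$ is the Möbius function.
   Context: For integers $m$, $\omega(m)=1$ if $m=0$; $\omega(m)=(-1)^i$ if $m=\frac{3i^2\pm i}{2}$ for some positive integer $i$; $\omega(m)=0$ otherwise (in particular for $m<0$). -}

module Defs where

open import Data.Nat as ℕ using (ℕ; zero; suc; _≡ᵇ_; _<ᵇ_)
open import Data.Nat.DivMod using (_%_; _/_)
open import Data.Bool using (Bool; true; false; if_then_else_; _∨_)
open import Data.Integer as ℤ using (ℤ; +_; -[1+_]; -_)
open import Data.List using (List; []; _∷_; map; upTo; foldr)

-- Pentagonal-number coefficient ω (as in the paper):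
-- ω(0) = 1; ω(m) = (-1)^i if m = (3i²±i)/2 with i ≥ 1; 0 otherwise (incl. m < 0).
-- For m = (3i² ± i)/2 with i ≥ 1 we have i ≤ m, so searching i ∈ [1, m] suffices.
-- The pentagonal numbers (3i²±i)/2, i ≥ 1, are pairwise distinct, so i is unique.
isPent : ℕ → ℕ → Bool
isPent m i = ((2 ℕ.* m) ≡ᵇ (3 ℕ.* i ℕ.* i ℕ.+ i)) ∨ ((2 ℕ.* m ℕ.+ i) ≡ᵇ (3 ℕ.* i ℕ.* i))

sign : ℕ → ℤ
sign zero = + 1
sign (suc i) = - sign i

ωℕ-search : ℕ → ℕ → ℤ
ωℕ-search m zero = + 0
ωℕ-search m (suc i) = if isPent m (suc i) then sign (suc i) else ωℕ-search m i

ω : ℤ → ℤ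
ω (+ zero) = + 1
ω (+ suc m) = ωℕ-search (suc m) (suc m)
ω -[1+ _ ] = + 0

-- Möbius function μ on positive integers, computed by trial division:
-- μ(1) = 1, μ(n) = 0 if p² ∣ n for some prime p, and μ(n) = (-1)^r if n is a
-- product of r distinct primes.  (μ 0 is set to 0; it is never used.)
-- mu-go fuel n q : the Möbius value of n, given n has no prime factor < p := q+2.
-- If p ∣ n then p is the smallest prime factor of n: value 0 if p² ∣ n, else -μ(n/p).
-- Fuel n suffices (each step decreases n or increases p ≤ n).
mu-go : ℕ → ℕ → ℕ → ℤ
mu-go zero n q = + 1
mu-go (suc fuel) n q =
  if n ℕ.<ᵇ 2 then + 1
  else if (n % suc (suc q)) ≡ᵇ 0
       then (if ((n / suc (suc q)) % suc (suc q)) ≡ᵇ 0 then + 0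
             else - mu-go fuel (n / suc (suc q)) (suc q))
       else mu-go fuel n (suc q)

μ : ℕ → ℤ
μ zero = + 0
μ (suc n) = mu-go (suc n) (suc n) 0

sumℤ : List ℤ → ℤ
sumℤ = foldr ℤ._+_ (+ 0)

-- Right-hand side:  Σ_{m+k=n, m≥1, k≥0} μ(m) Σ_{j≥0} ω(k − j m).
-- For j > k we have k − jm < 0 (m ≥ 1), so ω vanishes; summing j over [0, k] is exact.
innerSum : ℕ → ℕ → ℤ
innerSum m k = sumℤ (map (λ j → ω (+ k ℤ.- + (j ℕ.* m))) (upTo (suc k)))

rhs : ℕ → ℤ
rhs n = sumℤ (map (λ i → μ (suc i) ℤ.* innerSum (suc i) (n ℕ.∸ suc i)) (upTo n))

-- For m ≥ 1 the inner sum Σ_j ω(k − jm) equals the sum of ω(u) over 0 ≤ u < m + k with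
-- m ∣ m + k − u, since both are ω(k) for k < m and both grow by ω(m + k) when k grows by m.
-- Exchanging the two summations, the right-hand side becomes Σ_{u<n} ω(u) Σ_{d ∣ n−u} μ(d),
-- and Σ_{d∣t} μ(d) = 0 for t ≥ 2. For the latter, μ is read off its trial-division
-- definition: if p is the least prime factor of t = t′p, then μ(dp) = −[p ∤ d] μ(d) for
-- every d ∣ t′, while the divisors of t prime to p are exactly those of t′ prime to p;
-- so the divisors of t divisible by p cancel the others.
module Submission where

open import Defs
open import Data.Nat as ℕ using (ℕ; zero; suc; 2+; _≤_; _<_; _>_; _∸_; z≤n; s≤s; z<s; s<s; NonZero)
import Data.Nat.Properties as ℕ
open import Data.Nat.Divisibility
  using ( _∣_; _∤_; _∣?_; divides; ∣-refl; >⇒∤; ∣m+n∣m⇒∣n; ∣m∣n⇒∣m+n; n∣m*n; ∣m⇒∣m*n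
        ; *-monoˡ-∣; *-cancelʳ-∣; hasNonTrivialDivisor; hasNonTrivialDivisor-≤)
open import Data.Nat.DivMod using (_/_; m*n/n≡m)
open import Data.Nat.Coprimality as Coprimality using (Coprime; coprime-divisor)
open import Data.Nat.Primality
  using ( Prime; _Rough_; 2-rough; ∤⇒rough-suc; rough∧∣⇒rough; rough∧∣⇒prime
        ; prime⇒irreducible; prime⇒nonZero)
open import Data.Nat.Induction using (<-rec)
open import Data.Integer as ℤ using (ℤ; +_; -_; _+_; _*_; _-_)
import Data.Integer.Properties as ℤ
open import Algebra.Properties.CommutativeSemigroup ℤ.+-commutativeSemigroup using (interchange)
open import Algebra.Properties.CommutativeSemigroup ℤ.*-commutativeSemigroup
  using (x∙yz≈y∙xz; x∙yz≈z∙yx)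
open import Data.Bool using (if_then_else_)
open import Data.List using (map; applyUpTo)
open import Data.Product using (∃-syntax; _×_; _,_)
open import Data.Sum using (inj₁; inj₂)
open import Function using (_∘_; _⇔_; mk⇔; Equivalence)
open import Level using (Level)
open import Relation.Nullary using (Dec; yes; no; does; ¬_; ¬?; contradiction)
open import Relation.Nullary.Decidable using (dec-true; dec-false)
open import Relation.Binary.PropositionalEquality

private
  variable
    a b : Level
    A : Set a
    B : Set b
    f g : ℕ → ℤ
    m n : ℕ

∑< : ℕ → (ℕ → ℤ) → ℤ
∑< zero    f = + 0
∑< (suc n) f = f 0 + ∑< n (f ∘ suc)

infixr 6.5 ∑<
syntax ∑< n (λ i → x) = ∑[ i < n ] x

sumℤ-map-applyUpTo : ∀ f (h : ℕ → ℕ) n → sumℤ (map f (applyUpTo h n)) ≡ ∑< n (f ∘ h)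
sumℤ-map-applyUpTo f h zero    = refl
sumℤ-map-applyUpTo f h (suc n) = cong (λ s → f (h 0) + s) (sumℤ-map-applyUpTo f (h ∘ suc) n)

∑-cong : ∀ n → (∀ {i} → i < n → f i ≡ g i) → ∑< n f ≡ ∑< n g
∑-cong zero    _  = refl
∑-cong (suc n) eq = cong₂ _+_ (eq z<s) (∑-cong n (eq ∘ s<s))

∑-≡0 : ∀ n → (∀ {i} → i < n → f i ≡ + 0) → ∑< n f ≡ + 0
∑-≡0 zero    _  = refl
∑-≡0 (suc n) eq = cong₂ _+_ (eq z<s) (∑-≡0 n (eq ∘ s<s))

∑-distrib-+ : ∀ n f g → ∑[ i < n ] (f i + g i) ≡ ∑< n f + ∑< n g
∑-distrib-+ zero    f g = refl
∑-distrib-+ (suc n) f g =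
  trans (cong (λ s → f 0 + g 0 + s) (∑-distrib-+ n (f ∘ suc) (g ∘ suc))) (interchange (f 0) (g 0) _ _)

*-distribˡ-∑ : ∀ n c f → ∑[ i < n ] (c * f i) ≡ c * ∑< n f
*-distribˡ-∑ zero    c f = sym (ℤ.*-zeroʳ c)
*-distribˡ-∑ (suc n) c f =
  trans (cong (λ s → c * f 0 + s) (*-distribˡ-∑ n c (f ∘ suc))) (sym (ℤ.*-distribˡ-+ c (f 0) _))

neg-distrib-∑ : ∀ n f → ∑[ i < n ] (- f i) ≡ - ∑< n f
neg-distrib-∑ zero    f = refl
neg-distrib-∑ (suc n) f =
  trans (cong (λ s → - f 0 + s) (neg-distrib-∑ n (f ∘ suc))) (sym (ℤ.neg-distrib-+ (f 0) _))

∑-++ : ∀ m n f → ∑< (m ℕ.+ n) f ≡ ∑< m f + ∑[ i < n ] f (m ℕ.+ i)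
∑-++ zero    n f = sym (ℤ.+-identityˡ _)
∑-++ (suc m) n f = trans (cong (λ s → f 0 + s) (∑-++ m n (f ∘ suc))) (sym (ℤ.+-assoc (f 0) _ _))

∑-init-last : ∀ n f → ∑< (suc n) f ≡ ∑< n f + f n
∑-init-last zero    f = trans (ℤ.+-identityʳ (f 0)) (sym (ℤ.+-identityˡ (f 0)))
∑-init-last (suc n) f =
  trans (cong (λ s → f 0 + s) (∑-init-last n (f ∘ suc))) (sym (ℤ.+-assoc (f 0) _ _))

∑-comm : ∀ m n (h : ℕ → ℕ → ℤ) → ∑[ i < m ] ∑[ j < n ] h i j ≡ ∑[ j < n ] ∑[ i < m ] h i j
∑-comm zero    n h = sym (∑-≡0 n (λ _ → refl))
∑-comm (suc m) n h = trans (cong (λ s → ∑< n (h 0) + s) (∑-comm m n (h ∘ suc)))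
                           (sym (∑-distrib-+ n (h 0) (λ j → ∑[ i < m ] h (suc i) j)))

∑-truncate : ∀ f → m ≤ n → (∀ {i} → m ≤ i → i < n → f i ≡ + 0) → ∑< n f ≡ ∑< m f
∑-truncate {m} {n} f m≤n vanish with n ∸ m | ℕ.m+[n∸m]≡n m≤n
... | k | refl = begin
  ∑< (m ℕ.+ k) f                    ≡⟨ ∑-++ m k f ⟩
  ∑< m f + ∑[ i < k ] f (m ℕ.+ i)   ≡⟨ cong (λ s → ∑< m f + s) (∑-≡0 k tail) ⟩
  ∑< m f + + 0                      ≡⟨ ℤ.+-identityʳ _ ⟩
  ∑< m f                            ∎
  where
  open ≡-Reasoning
  tail : ∀ {i} → i < k → f (m ℕ.+ i) ≡ + 0
  tail i<k = vanish (ℕ.m≤m+n m _) (ℕ.+-monoʳ-< m i<k)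

∑-multiples : ∀ m .{{_ : NonZero m}} N (h : ℕ → ℤ) → (∀ {d} → m ∤ d → h d ≡ + 0) →
              ∑[ i < N ℕ.* m ] h (suc i) ≡ ∑[ j < N ] h (suc j ℕ.* m)
∑-multiples (suc m) zero    h vanish = refl
∑-multiples (suc m) (suc N) h vanish = begin
  ∑[ i < M ℕ.+ N ℕ.* M ] h (suc i)
    ≡⟨ ∑-++ M (N ℕ.* M) (h ∘ suc) ⟩
  ∑[ i < M ] h (suc i) + ∑[ i < N ℕ.* M ] h (suc (M ℕ.+ i))
    ≡⟨ cong₂ _+_ firstBlock (∑-cong (N ℕ.* M) (λ _ → cong h (sym (ℕ.+-suc M _)))) ⟩
  h (1 ℕ.* M) + ∑[ i < N ℕ.* M ] h (M ℕ.+ suc i)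
    ≡⟨ cong (λ s → h (1 ℕ.* M) + s) (∑-multiples M N (h ∘ (M ℕ.+_)) vanishShifted) ⟩
  ∑[ j < suc N ] h (suc j ℕ.* M) ∎
  where
  open ≡-Reasoning
  M = suc m
  firstBlock : ∑[ i < M ] h (suc i) ≡ h (1 ℕ.* M)
  firstBlock = begin
    ∑[ i < M ] h (suc i)         ≡⟨ ∑-init-last m (h ∘ suc) ⟩
    ∑[ i < m ] h (suc i) + h M   ≡⟨ cong (λ s → s + h M) (∑-≡0 m (λ i<m → vanish (>⇒∤ (s<s i<m)))) ⟩
    + 0 + h M                    ≡⟨ ℤ.+-identityˡ _ ⟩
    h M                          ≡⟨ cong h (ℕ.*-identityˡ M) ⟨
    h (1 ℕ.* M)                  ∎
  vanishShifted : ∀ {d} → M ∤ d → h (M ℕ.+ d) ≡ + 0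
  vanishShifted M∤d = vanish (λ M∣M+d → M∤d (∣m+n∣m⇒∣n M∣M+d ∣-refl))

𝟙 : Dec A → ℤ
𝟙 (yes _) = + 1
𝟙 (no  _) = + 0

𝟙-yes : (a? : Dec A) → A → 𝟙 a? ≡ + 1
𝟙-yes (yes _) _ = refl
𝟙-yes (no ¬a) a = contradiction a ¬a

𝟙-no : (a? : Dec A) → ¬ A → 𝟙 a? ≡ + 0
𝟙-no (yes a) ¬a = contradiction a ¬a
𝟙-no (no _)  _  = refl

𝟙-cong : (a? : Dec A) (b? : Dec B) → A ⇔ B → 𝟙 a? ≡ 𝟙 b?
𝟙-cong (yes a) b? A⇔B = sym (𝟙-yes b? (Equivalence.to A⇔B a))
𝟙-cong (no ¬a) b? A⇔B = sym (𝟙-no b? (¬a ∘ Equivalence.from A⇔B))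

𝟙-*-cong : (a? : Dec A) {x y : ℤ} → (A → x ≡ y) → 𝟙 a? * x ≡ 𝟙 a? * y
𝟙-*-cong (yes a) x≡y = cong (λ z → + 1 * z) (x≡y a)
𝟙-*-cong (no _)  _   = refl

𝟙-¬?-split : (a? : Dec A) (x : ℤ) → 𝟙 (¬? a?) * x + 𝟙 a? * x ≡ x
𝟙-¬?-split (yes _) x = trans (ℤ.+-identityˡ _) (ℤ.*-identityˡ x)
𝟙-¬?-split (no _)  x = trans (ℤ.+-identityʳ _) (ℤ.*-identityˡ x)

<⇒∤ : 0 < n → n < m → m ∤ n
<⇒∤ {suc _} _ n<m = >⇒∤ n<m

congruentSum : ℕ → ℕ → (ℕ → ℤ) → ℤ
congruentSum m n f = ∑[ u < n ] 𝟙 (m ∣? n ∸ u) * f u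

congruentSum-< : ∀ {k} f → k < m → congruentSum m k f ≡ + 0
congruentSum-< {m} {k} f k<m = ∑-≡0 k λ {u} u<k →
  cong (_* f u) (𝟙-no (m ∣? k ∸ u) (<⇒∤ (ℕ.m<n⇒0<n∸m u<k) (ℕ.≤-<-trans (ℕ.m∸n≤m k u) k<m)))

congruentSum-+ : ∀ m f k → congruentSum (suc m) (suc m ℕ.+ k) f ≡ congruentSum (suc m) k f + f k
congruentSum-+ m f k = begin
  congruentSum M (M ℕ.+ k) f
    ≡⟨ cong (λ n → congruentSum M n f) (ℕ.+-comm M k) ⟩
  ∑[ u < k ℕ.+ M ] 𝟙 (M ∣? k ℕ.+ M ∸ u) * f u
    ≡⟨ ∑-++ k M _ ⟩
  ∑[ u < k ] 𝟙 (M ∣? k ℕ.+ M ∸ u) * f u + ∑[ i < M ] 𝟙 (M ∣? k ℕ.+ M ∸ (k ℕ.+ i)) * f (k ℕ.+ i)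
    ≡⟨ cong₂ _+_ (∑-cong k early) (∑-cong M late) ⟩
  congruentSum M k f + ∑[ i < M ] 𝟙 (M ∣? M ∸ i) * f (k ℕ.+ i)
    ≡⟨ cong (λ s → congruentSum M k f + s) lastBlock ⟩
  congruentSum M k f + f k ∎
  where
  open ≡-Reasoning
  M = suc m
  M∣x+M⇔M∣x : ∀ x → M ∣ x ℕ.+ M ⇔ M ∣ x
  M∣x+M⇔M∣x x = mk⇔ (λ M∣x+M → ∣m+n∣m⇒∣n (subst (M ∣_) (ℕ.+-comm x M) M∣x+M) ∣-refl)
                    (λ M∣x → ∣m∣n⇒∣m+n M∣x ∣-refl)
  early : ∀ {u} → u < k → 𝟙 (M ∣? k ℕ.+ M ∸ u) * f u ≡ 𝟙 (M ∣? k ∸ u) * f u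
  early {u} u<k = cong (_* f u) (begin
    𝟙 (M ∣? k ℕ.+ M ∸ u)   ≡⟨ cong (λ x → 𝟙 (M ∣? x)) (ℕ.+-∸-comm M (ℕ.<⇒≤ u<k)) ⟩
    𝟙 (M ∣? k ∸ u ℕ.+ M)   ≡⟨ 𝟙-cong _ _ (M∣x+M⇔M∣x (k ∸ u)) ⟩
    𝟙 (M ∣? k ∸ u)         ∎)
  late : ∀ {i} → i < M → 𝟙 (M ∣? k ℕ.+ M ∸ (k ℕ.+ i)) * f (k ℕ.+ i) ≡ 𝟙 (M ∣? M ∸ i) * f (k ℕ.+ i)
  late {i} _ = cong (λ x → 𝟙 (M ∣? x) * f (k ℕ.+ i)) (ℕ.[m+n]∸[m+o]≡n∸o k M i)
  lastBlock : ∑[ i < M ] 𝟙 (M ∣? M ∸ i) * f (k ℕ.+ i) ≡ f k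
  lastBlock = begin
    𝟙 (M ∣? M) * f (k ℕ.+ 0) + ∑[ i < m ] 𝟙 (M ∣? m ∸ i) * f (k ℕ.+ suc i)
      ≡⟨ cong₂ _+_ (cong (_* f (k ℕ.+ 0)) (𝟙-yes (M ∣? M) ∣-refl)) (∑-≡0 m (λ {i} i<m →
           cong (_* f (k ℕ.+ suc i)) (𝟙-no (M ∣? m ∸ i) (<⇒∤ (ℕ.m<n⇒0<n∸m i<m) (s≤s (ℕ.m∸n≤m m i)))))) ⟩
    + 1 * f (k ℕ.+ 0) + + 0
      ≡⟨ trans (ℤ.+-identityʳ _) (ℤ.*-identityˡ _) ⟩
    f (k ℕ.+ 0)
      ≡⟨ cong f (ℕ.+-identityʳ k) ⟩
    f k ∎

ω-neg : ∀ {a b} → a < b → ω (+ a - + b) ≡ + 0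
ω-neg {a} {suc b} (s≤s a≤b) = cong ω (begin
  + a - + suc b      ≡⟨ ℤ.m-n≡m⊖n a (suc b) ⟩
  a ℤ.⊖ suc b        ≡⟨ ℤ.⊖-< (s≤s a≤b) ⟩
  - + (suc b ∸ a)    ≡⟨ cong (λ x → - + x) (ℕ.+-∸-assoc 1 a≤b) ⟩
  - + suc (b ∸ a)    ∎)
  where open ≡-Reasoning

[m+n]-[m+o]≡n-o : ∀ m n o → + (m ℕ.+ n) - + (m ℕ.+ o) ≡ + n - + o
[m+n]-[m+o]≡n-o m n o =
  trans (ℤ.m-n≡m⊖n (m ℕ.+ n) (m ℕ.+ o)) (trans (ℤ.+-cancelˡ-⊖ m n o) (sym (ℤ.m-n≡m⊖n n o)))

innerSum-∑ : ∀ m k → innerSum m k ≡ ∑[ j < suc k ] ω (+ k - + (j ℕ.* m))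
innerSum-∑ m k = sumℤ-map-applyUpTo (λ j → ω (+ k - + (j ℕ.* m))) (λ j → j) (suc k)

innerSum-< : ∀ m {k} → k < suc m → innerSum (suc m) k ≡ ω (+ k)
innerSum-< m {k} k<M = begin
  innerSum M k         ≡⟨ innerSum-∑ M k ⟩
  ∑[ j < suc k ] φ j   ≡⟨ ∑-truncate φ (s≤s z≤n) vanish ⟩
  φ 0 + + 0            ≡⟨ ℤ.+-identityʳ _ ⟩
  φ 0                  ≡⟨ cong (λ x → ω (+ x)) (ℕ.+-identityʳ k) ⟩
  ω (+ k)              ∎
  where
  open ≡-Reasoning
  M = suc m
  φ : ℕ → ℤ
  φ j = ω (+ k - + (j ℕ.* M))
  vanish : ∀ {j} → 1 ≤ j → j < suc k → φ j ≡ + 0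
  vanish {suc j} _ _ = ω-neg (ℕ.<-≤-trans k<M (ℕ.m≤m+n M (j ℕ.* M)))

innerSum-+ : ∀ m k → innerSum (suc m) (suc m ℕ.+ k) ≡ innerSum (suc m) k + ω (+ (suc m ℕ.+ k))
innerSum-+ m k = begin
  innerSum M (M ℕ.+ k)
    ≡⟨ innerSum-∑ M (M ℕ.+ k) ⟩
  ω (+ (M ℕ.+ k) - + 0) + ∑[ j < M ℕ.+ k ] ω (+ (M ℕ.+ k) - + (M ℕ.+ j ℕ.* M))
    ≡⟨ cong₂ _+_ (cong (λ x → ω (+ x)) (ℕ.+-identityʳ (M ℕ.+ k)))
                 (∑-cong (M ℕ.+ k) (λ {j} _ → cong ω ([m+n]-[m+o]≡n-o M k (j ℕ.* M)))) ⟩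
  ω (+ (M ℕ.+ k)) + ∑[ j < M ℕ.+ k ] φ j
    ≡⟨ cong (λ s → ω (+ (M ℕ.+ k)) + s) (∑-truncate φ (ℕ.+-monoˡ-≤ k (s≤s z≤n)) vanish) ⟩
  ω (+ (M ℕ.+ k)) + ∑[ j < suc k ] φ j
    ≡⟨ cong (λ s → ω (+ (M ℕ.+ k)) + s) (innerSum-∑ M k) ⟨
  ω (+ (M ℕ.+ k)) + innerSum M k
    ≡⟨ ℤ.+-comm (ω (+ (M ℕ.+ k))) (innerSum M k) ⟩
  innerSum M k + ω (+ (M ℕ.+ k)) ∎
  where
  open ≡-Reasoning
  M = suc m
  φ : ℕ → ℤ
  φ j = ω (+ k - + (j ℕ.* M))
  vanish : ∀ {j} → suc k ≤ j → j < M ℕ.+ k → φ j ≡ + 0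
  vanish {j} k<j _ = ω-neg (ℕ.<-≤-trans k<j (ℕ.m≤m*n j M))

innerSum≡congruentSum : ∀ m k → innerSum (suc m) k ≡ congruentSum (suc m) (suc m ℕ.+ k) (ω ∘ +_)
innerSum≡congruentSum m = <-rec P step
  where
  open ≡-Reasoning
  M = suc m
  P : ℕ → Set
  P k = innerSum M k ≡ congruentSum M (M ℕ.+ k) (ω ∘ +_)
  step : ∀ k → (∀ {r} → r < k → P r) → P k
  step k rec with k ℕ.<? M
  ... | yes k<M = begin
    innerSum M k                          ≡⟨ innerSum-< m k<M ⟩
    ω (+ k)                               ≡⟨ ℤ.+-identityˡ _ ⟨
    + 0 + ω (+ k)                         ≡⟨ cong (λ s → s + ω (+ k)) (congruentSum-< (ω ∘ +_) k<M) ⟨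
    congruentSum M k (ω ∘ +_) + ω (+ k)   ≡⟨ congruentSum-+ m (ω ∘ +_) k ⟨
    congruentSum M (M ℕ.+ k) (ω ∘ +_)     ∎
  ... | no k≮M with k ∸ M | ℕ.m+[n∸m]≡n (ℕ.≮⇒≥ k≮M)
  ...   | r | refl = begin
    innerSum M (M ℕ.+ r)                                  ≡⟨ innerSum-+ m r ⟩
    innerSum M r + ω (+ (M ℕ.+ r))                        ≡⟨ cong (λ s → s + ω (+ (M ℕ.+ r))) (rec r<M+r) ⟩
    congruentSum M (M ℕ.+ r) (ω ∘ +_) + ω (+ (M ℕ.+ r))   ≡⟨ congruentSum-+ m (ω ∘ +_) (M ℕ.+ r) ⟨
    congruentSum M (M ℕ.+ (M ℕ.+ r)) (ω ∘ +_)             ∎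
    where r<M+r = ℕ.m<n+m r z<s

mu-go-1 : ∀ f q → mu-go f 1 q ≡ + 1
mu-go-1 zero    q = refl
mu-go-1 (suc f) q = refl

-- For a divisor of the form 2+ q, the test n % 2+ q ≡ᵇ 0 in mu-go is definitionally
-- does (2+ q ∣? n), so dec-true and dec-false select its branches.
mu-go-∤ : ∀ f n q → 2+ q ∤ 2+ n → mu-go (suc f) (2+ n) q ≡ mu-go f (2+ n) (suc q)
mu-go-∤ f n q p∤n =
  cong (λ b → if b then divisorBranch else mu-go f (2+ n) (suc q)) (dec-false (2+ q ∣? 2+ n) p∤n)
  where
  divisorBranch : ℤ
  divisorBranch = if does (2+ q ∣? 2+ n / 2+ q) then + 0 else - mu-go f (2+ n / 2+ q) (suc q)

mu-go-* : ∀ f d q → mu-go (suc f) (suc d ℕ.* 2+ q) q ≡ - (𝟙 (¬? (2+ q ∣? suc d)) * mu-go f (suc d) (suc q))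
mu-go-* f d q = begin
  mu-go (suc f) N q
    ≡⟨ cong (λ b → if b then divisorBranch (N / p) else mu-go f N (suc q))
            (dec-true (p ∣? N) (n∣m*n (suc d))) ⟩
  divisorBranch (N / p)
    ≡⟨ cong divisorBranch (m*n/n≡m (suc d) p) ⟩
  divisorBranch (suc d)
    ≡⟨ branch≡𝟙 (p ∣? suc d) ⟩
  - (𝟙 (¬? (p ∣? suc d)) * mu-go f (suc d) (suc q)) ∎
  where
  open ≡-Reasoning
  p N : ℕ
  p = 2+ q
  N = suc d ℕ.* p
  divisorBranch : ℕ → ℤ
  divisorBranch m = if does (p ∣? m) then + 0 else - mu-go f m (suc q)
  branch≡𝟙 : (a? : Dec A) → (if does a? then + 0 else - mu-go f (suc d) (suc q))
                           ≡ - (𝟙 (¬? a?) * mu-go f (suc d) (suc q))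
  branch≡𝟙 (yes _) = refl
  branch≡𝟙 (no _)  = cong -_ (sym (ℤ.*-identityˡ _))

-- A trial step spends one unit of fuel and raises the trial divisor 2 + q by one, and the
-- trial divisor never exceeds n; hence fuel f is enough as soon as n ≤ f + suc q.
mu-go-fuel : ∀ {f f′} q n → 1 ≤ n → 2+ q Rough n → n ≤ f ℕ.+ suc q → n ≤ f′ ℕ.+ suc q →
             mu-go f n q ≡ mu-go f′ n q
mu-go-fuel {f} {f′} q 1 _ _ _ _ = trans (mu-go-1 f q) (sym (mu-go-1 f′ q))
mu-go-fuel {zero} q (2+ n) _ rough enough _ =
  contradiction (hasNonTrivialDivisor (s≤s enough) ∣-refl) rough
mu-go-fuel {suc _} {zero} q (2+ n) _ rough _ enough =
  contradiction (hasNonTrivialDivisor (s≤s enough) ∣-refl) rough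
mu-go-fuel {suc g} {suc g′} q (2+ n) _ rough enough enough′ with 2+ q ∣? 2+ n
... | no p∤n = begin
  mu-go (suc g) (2+ n) q    ≡⟨ mu-go-∤ g n q p∤n ⟩
  mu-go g (2+ n) (suc q)    ≡⟨ mu-go-fuel (suc q) (2+ n) (s≤s z≤n) (∤⇒rough-suc p∤n rough)
                                 (fuel-suc g enough) (fuel-suc g′ enough′) ⟩
  mu-go g′ (2+ n) (suc q)   ≡⟨ mu-go-∤ g′ n q p∤n ⟨
  mu-go (suc g′) (2+ n) q   ∎
  where
  open ≡-Reasoning
  fuel-suc : ∀ h → 2+ n ≤ suc h ℕ.+ suc q → 2+ n ≤ h ℕ.+ 2+ q
  fuel-suc h = subst (2+ n ≤_) (sym (ℕ.+-suc h (suc q)))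
... | yes (divides (suc d) refl) = begin
  mu-go (suc g) (suc d ℕ.* p) q
    ≡⟨ mu-go-* g d q ⟩
  - (𝟙 (¬? (p ∣? suc d)) * mu-go g (suc d) (suc q))
    ≡⟨ cong -_ (𝟙-*-cong (¬? (p ∣? suc d)) quotientsAgree) ⟩
  - (𝟙 (¬? (p ∣? suc d)) * mu-go g′ (suc d) (suc q))
    ≡⟨ mu-go-* g′ d q ⟨
  mu-go (suc g′) (suc d ℕ.* p) q ∎
  where
  open ≡-Reasoning
  p = 2+ q
  fuel-quotient : ∀ h → suc d ℕ.* p ≤ suc h ℕ.+ suc q → suc d ≤ h ℕ.+ 2+ q
  fuel-quotient h enough =
    ℕ.≤-trans (ℕ.m≤m*n (suc d) p) (subst (suc d ℕ.* p ≤_) (sym (ℕ.+-suc h (suc q))) enough)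
  quotientsAgree : p ∤ suc d → mu-go g (suc d) (suc q) ≡ mu-go g′ (suc d) (suc q)
  quotientsAgree p∤d = mu-go-fuel (suc q) (suc d) (s≤s z≤n)
    (∤⇒rough-suc p∤d (rough∧∣⇒rough rough (∣m⇒∣m*n p ∣-refl)))
    (fuel-quotient g enough) (fuel-quotient g′ enough′)

mu-go≡μ : ∀ q {f n} → 1 ≤ n → 2+ q Rough n → n ≤ f ℕ.+ suc q → mu-go f n q ≡ μ n
mu-go≡μ zero    {f} {suc n} _ rough enough =
  mu-go-fuel 0 (suc n) (s≤s z≤n) rough enough (ℕ.m≤m+n (suc n) 1)
mu-go≡μ (suc q) {f} {1}     _ _     _      = mu-go-1 f (suc q)
mu-go≡μ (suc q) {f} {2+ n}  _ rough enough = begin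
  mu-go f (2+ n) (suc q)   ≡⟨ mu-go-∤ f n q (λ p∣n → rough (hasNonTrivialDivisor (ℕ.n<1+n (2+ q)) p∣n)) ⟨
  mu-go (suc f) (2+ n) q   ≡⟨ mu-go≡μ q (s≤s z≤n) (rough ∘ λ h → hasNonTrivialDivisor-≤ h (ℕ.n≤1+n _))
                                (subst (2+ n ≤_) (ℕ.+-suc f (suc q)) enough) ⟩
  μ (2+ n)                 ∎
  where open ≡-Reasoning

μ-*-rough : ∀ q d → 2+ q Rough (suc d ℕ.* 2+ q) →
            μ (suc d ℕ.* 2+ q) ≡ - (𝟙 (¬? (2+ q ∣? suc d)) * μ (suc d))
μ-*-rough q d rough = begin
  μ N                                                    ≡⟨ mu-go≡μ q (s≤s z≤n) rough (ℕ.m≤m+n N (suc q)) ⟨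
  mu-go N N q                                            ≡⟨ mu-go-* fuel d q ⟩
  - (𝟙 (¬? (p ∣? suc d)) * mu-go fuel (suc d) (suc q))   ≡⟨ cong -_ (𝟙-*-cong (¬? (p ∣? suc d)) quotient) ⟩
  - (𝟙 (¬? (p ∣? suc d)) * μ (suc d))                    ∎
  where
  open ≡-Reasoning
  p N fuel : ℕ
  p = 2+ q
  N = suc d ℕ.* p
  fuel = suc (q ℕ.+ d ℕ.* p)
  quotient : p ∤ suc d → mu-go fuel (suc d) (suc q) ≡ μ (suc d)
  quotient p∤d = mu-go≡μ (suc q) (s≤s z≤n) (∤⇒rough-suc p∤d (rough∧∣⇒rough rough (∣m⇒∣m*n p ∣-refl)))
                   (ℕ.≤-trans (ℕ.m≤m*n (suc d) p) (ℕ.m<m+n fuel z<s))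

leastPrimeFactor : ∀ t → 2 ≤ t → ∃[ q ] 2+ q ∣ t × 2+ q Rough t
leastPrimeFactor t 2≤t = search 0 (t ∸ 2) 2-rough (ℕ.m∸n+n≡m 2≤t)
  where
  search : ∀ q k → 2+ q Rough t → k ℕ.+ 2+ q ≡ t → ∃[ q ] 2+ q ∣ t × 2+ q Rough t
  search q zero    rough eq = q , subst (2+ q ∣_) eq ∣-refl , rough
  search q (suc k) rough eq with 2+ q ∣? t
  ... | yes p∣t = q , p∣t , rough
  ... | no  p∤t = search (suc q) k (∤⇒rough-suc p∤t rough) (trans (ℕ.+-suc k (2+ q)) eq)

prime∤⇒coprime : ∀ {p d} → Prime p → p ∤ d → Coprime p d
prime∤⇒coprime pp p∤d (c∣p , c∣d) with prime⇒irreducible pp c∣p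
... | inj₁ c≡1  = c≡1
... | inj₂ refl = contradiction c∣d p∤d

divisorSum : (ℕ → ℤ) → ℕ → ℤ
divisorSum g t = ∑[ i < t ] 𝟙 (suc i ∣? t) * g (suc i)

divisorSum-cong : ∀ t f g → (∀ {d} → suc d ∣ t → f (suc d) ≡ g (suc d)) → divisorSum f t ≡ divisorSum g t
divisorSum-cong t f g eq = ∑-cong t (λ {i} _ → 𝟙-*-cong (suc i ∣? t) eq)

divisorSum-neg : ∀ t g → divisorSum (λ d → - g d) t ≡ - divisorSum g t
divisorSum-neg t g = trans (∑-cong t (λ {i} _ → sym (ℤ.neg-distribʳ-* (𝟙 (suc i ∣? t)) (g (suc i)))))
                           (neg-distrib-∑ t (λ i → 𝟙 (suc i ∣? t) * g (suc i)))

divisorSum-extend : ∀ {t N} g .{{_ : NonZero t}} → t ≤ N →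
                    ∑[ i < N ] 𝟙 (suc i ∣? t) * g (suc i) ≡ divisorSum g t
divisorSum-extend {t} g t≤N =
  ∑-truncate _ t≤N (λ {i} t≤i _ → cong (_* g (suc i)) (𝟙-no (suc i ∣? t) (>⇒∤ (s≤s t≤i))))

divisorSum-*-prime : ∀ {p} → Prime p → ∀ t g →
  divisorSum g (suc t ℕ.* p) ≡
  divisorSum (λ d → 𝟙 (¬? (p ∣? d)) * g d) (suc t) + divisorSum (λ d → g (d ℕ.* p)) (suc t)
divisorSum-*-prime {p} pp t g = begin
  divisorSum g N
    ≡⟨ ∑-cong N (λ {i} _ → 𝟙-¬?-split (p ∣? suc i) (term (suc i))) ⟨
  ∑[ i < N ] (𝟙 (¬? (p ∣? suc i)) * term (suc i) + 𝟙 (p ∣? suc i) * term (suc i))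
    ≡⟨ ∑-distrib-+ N _ _ ⟩
  ∑[ i < N ] 𝟙 (¬? (p ∣? suc i)) * term (suc i) + ∑[ i < N ] 𝟙 (p ∣? suc i) * term (suc i)
    ≡⟨ cong₂ _+_ coprimePart multiplesPart ⟩
  divisorSum (λ d → 𝟙 (¬? (p ∣? d)) * g d) T + divisorSum (λ d → g (d ℕ.* p)) T ∎
  where
  open ≡-Reasoning
  instance _ = prime⇒nonZero pp
  T N : ℕ
  T = suc t
  N = T ℕ.* p
  term : ℕ → ℤ
  term d = 𝟙 (d ∣? N) * g d
  coprime⇔ : ∀ {d} → p ∤ d → d ∣ N ⇔ d ∣ T
  coprime⇔ {d} p∤d = mk⇔
    (λ d∣N → coprime-divisor (Coprimality.sym (prime∤⇒coprime pp p∤d)) (subst (d ∣_) (ℕ.*-comm T p) d∣N))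
    (∣m⇒∣m*n p)
  coprimePart : ∑[ i < N ] 𝟙 (¬? (p ∣? suc i)) * term (suc i) ≡ divisorSum (λ d → 𝟙 (¬? (p ∣? d)) * g d) T
  coprimePart = begin
    ∑[ i < N ] 𝟙 (¬? (p ∣? suc i)) * (𝟙 (suc i ∣? N) * g (suc i))
      ≡⟨ ∑-cong N (λ {i} _ → 𝟙-*-cong (¬? (p ∣? suc i)) λ p∤d →
           cong (_* g (suc i)) (𝟙-cong (suc i ∣? N) (suc i ∣? T) (coprime⇔ p∤d))) ⟩
    ∑[ i < N ] 𝟙 (¬? (p ∣? suc i)) * (𝟙 (suc i ∣? T) * g (suc i))
      ≡⟨ ∑-cong N (λ {i} _ → x∙yz≈y∙xz (𝟙 (¬? (p ∣? suc i))) (𝟙 (suc i ∣? T)) (g (suc i))) ⟩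
    ∑[ i < N ] 𝟙 (suc i ∣? T) * (𝟙 (¬? (p ∣? suc i)) * g (suc i))
      ≡⟨ divisorSum-extend (λ d → 𝟙 (¬? (p ∣? d)) * g d) (ℕ.m≤m*n T p) ⟩
    divisorSum (λ d → 𝟙 (¬? (p ∣? d)) * g d) T ∎
  multiple : ∀ e → 𝟙 (p ∣? e ℕ.* p) * term (e ℕ.* p) ≡ 𝟙 (e ∣? T) * g (e ℕ.* p)
  multiple e = begin
    𝟙 (p ∣? e ℕ.* p) * (𝟙 (e ℕ.* p ∣? N) * g (e ℕ.* p))
      ≡⟨ cong (_* term (e ℕ.* p)) (𝟙-yes (p ∣? e ℕ.* p) (n∣m*n e)) ⟩
    + 1 * (𝟙 (e ℕ.* p ∣? N) * g (e ℕ.* p))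
      ≡⟨ ℤ.*-identityˡ _ ⟩
    𝟙 (e ℕ.* p ∣? N) * g (e ℕ.* p)
      ≡⟨ cong (_* g (e ℕ.* p)) (𝟙-cong (e ℕ.* p ∣? N) (e ∣? T) (mk⇔ (*-cancelʳ-∣ p) (*-monoˡ-∣ p))) ⟩
    𝟙 (e ∣? T) * g (e ℕ.* p) ∎
  multiplesPart : ∑[ i < N ] 𝟙 (p ∣? suc i) * term (suc i) ≡ divisorSum (λ d → g (d ℕ.* p)) T
  multiplesPart = begin
    ∑[ i < T ℕ.* p ] 𝟙 (p ∣? suc i) * term (suc i)
      ≡⟨ ∑-multiples p T (λ d → 𝟙 (p ∣? d) * term d) (λ {d} p∤d → cong (_* term d) (𝟙-no (p ∣? d) p∤d)) ⟩
    ∑[ j < T ] 𝟙 (p ∣? suc j ℕ.* p) * term (suc j ℕ.* p)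
      ≡⟨ ∑-cong T (λ {j} _ → multiple (suc j)) ⟩
    divisorSum (λ d → g (d ℕ.* p)) T ∎

divisorSum-μ : ∀ t → divisorSum μ (2+ t) ≡ + 0
divisorSum-μ t with leastPrimeFactor (2+ t) (s≤s (s≤s z≤n))
... | q , divides zero () , _
... | q , divides (suc d) refl , rough = begin
  divisorSum μ (suc d ℕ.* p)
    ≡⟨ divisorSum-*-prime (rough∧∣⇒prime rough (n∣m*n (suc d))) d μ ⟩
  coprimeSum + divisorSum (λ e → μ (e ℕ.* p)) (suc d)
    ≡⟨ cong (λ s → coprimeSum + s) multiplesSum ⟩
  coprimeSum + - coprimeSum
    ≡⟨ ℤ.+-inverseʳ coprimeSum ⟩
  + 0 ∎
  where
  open ≡-Reasoning
  p = 2+ q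
  coprimeSum : ℤ
  coprimeSum = divisorSum (λ e → 𝟙 (¬? (p ∣? e)) * μ e) (suc d)
  multiplesSum : divisorSum (λ e → μ (e ℕ.* p)) (suc d) ≡ - coprimeSum
  multiplesSum = trans
    (divisorSum-cong (suc d) (λ e → μ (e ℕ.* p)) (λ e → - (𝟙 (¬? (p ∣? e)) * μ e))
      (λ {e} e∣d → μ-*-rough q e (rough∧∣⇒rough rough (*-monoˡ-∣ p e∣d))))
    (divisorSum-neg (suc d) (λ e → 𝟙 (¬? (p ∣? e)) * μ e))

∑-μ-congruentSum : ∀ n f → ∑[ i < suc n ] μ (suc i) * congruentSum (suc i) (suc n) f ≡ f n
∑-μ-congruentSum n f = begin
  ∑[ i < N ] μ (suc i) * (∑[ u < N ] 𝟙 (suc i ∣? N ∸ u) * f u)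
    ≡⟨ ∑-cong N (λ {i} _ → *-distribˡ-∑ N (μ (suc i)) (λ u → 𝟙 (suc i ∣? N ∸ u) * f u)) ⟨
  ∑[ i < N ] ∑[ u < N ] μ (suc i) * (𝟙 (suc i ∣? N ∸ u) * f u)
    ≡⟨ ∑-comm N N (λ i u → μ (suc i) * (𝟙 (suc i ∣? N ∸ u) * f u)) ⟩
  ∑[ u < N ] ∑[ i < N ] μ (suc i) * (𝟙 (suc i ∣? N ∸ u) * f u)
    ≡⟨ ∑-cong N coefficient ⟩
  ∑[ u < N ] f u * divisorSum μ (N ∸ u)
    ≡⟨ ∑-init-last n (λ u → f u * divisorSum μ (N ∸ u)) ⟩
  ∑[ u < n ] f u * divisorSum μ (N ∸ u) + f n * divisorSum μ (N ∸ n)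
    ≡⟨ cong₂ _+_ (∑-≡0 n vanish) (cong (λ t → f n * divisorSum μ t) (ℕ.m+n∸n≡m 1 n)) ⟩
  + 0 + f n * + 1
    ≡⟨ trans (ℤ.+-identityˡ _) (ℤ.*-identityʳ (f n)) ⟩
  f n ∎
  where
  open ≡-Reasoning
  N = suc n
  coefficient : ∀ {u} → u < N →
                ∑[ i < N ] μ (suc i) * (𝟙 (suc i ∣? N ∸ u) * f u) ≡ f u * divisorSum μ (N ∸ u)
  coefficient {u} u<N = begin
    ∑[ i < N ] μ (suc i) * (𝟙 (suc i ∣? N ∸ u) * f u)
      ≡⟨ ∑-cong N (λ {i} _ → x∙yz≈z∙yx (μ (suc i)) (𝟙 (suc i ∣? N ∸ u)) (f u)) ⟩
    ∑[ i < N ] f u * (𝟙 (suc i ∣? N ∸ u) * μ (suc i))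
      ≡⟨ *-distribˡ-∑ N (f u) (λ i → 𝟙 (suc i ∣? N ∸ u) * μ (suc i)) ⟩
    f u * (∑[ i < N ] 𝟙 (suc i ∣? N ∸ u) * μ (suc i))
      ≡⟨ cong (f u *_) (divisorSum-extend μ (ℕ.m∸n≤m N u)) ⟩
    f u * divisorSum μ (N ∸ u) ∎
    where instance _ = ℕ.>-nonZero (ℕ.m<n⇒0<n∸m u<N)
  vanish : ∀ {u} → u < n → f u * divisorSum μ (N ∸ u) ≡ + 0
  vanish {u} u<n = begin
    f u * divisorSum μ (N ∸ u)            ≡⟨ cong (λ t → f u * divisorSum μ t) N∸u≡2+ ⟩
    f u * divisorSum μ (2+ (n ∸ suc u))   ≡⟨ cong (f u *_) (divisorSum-μ (n ∸ suc u)) ⟩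
    f u * + 0                             ≡⟨ ℤ.*-zeroʳ (f u) ⟩
    + 0                                   ∎
    where
    N∸u≡2+ : N ∸ u ≡ 2+ (n ∸ suc u)
    N∸u≡2+ = trans (ℕ.+-∸-assoc 1 (ℕ.<⇒≤ u<n)) (cong suc (ℕ.+-∸-assoc 1 u<n))

mainTheorem11 : (n : ℕ) → n > 1 → ω (+ (n ∸ 1)) ≡ rhs n
mainTheorem11 (suc n) _ = begin
  ω (+ n)
    ≡⟨ ∑-μ-congruentSum n (ω ∘ +_) ⟨
  ∑[ i < suc n ] μ (suc i) * congruentSum (suc i) (suc n) (ω ∘ +_)
    ≡⟨ ∑-cong (suc n) (λ {i} i<N → cong (μ (suc i) *_) (innerSum-as-congruentSum i<N)) ⟨
  ∑[ i < suc n ] μ (suc i) * innerSum (suc i) (suc n ∸ suc i)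
    ≡⟨ sumℤ-map-applyUpTo (λ i → μ (suc i) * innerSum (suc i) (suc n ∸ suc i)) (λ i → i) (suc n) ⟨
  rhs (suc n) ∎
  where
  open ≡-Reasoning
  innerSum-as-congruentSum : ∀ {i} → i < suc n →
                             innerSum (suc i) (suc n ∸ suc i) ≡ congruentSum (suc i) (suc n) (ω ∘ +_)
  innerSum-as-congruentSum {i} i<N = trans (innerSum≡congruentSum i (suc n ∸ suc i))
                                           (cong (λ x → congruentSum (suc i) x (ω ∘ +_)) (ℕ.m+[n∸m]≡n i<N))
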